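{- Let $G$ be an $n$-vertex outerplanar graph and let $\mathcal{H},\mathcal{K}$ be non-piercing families of subgraphs of $G$. Then $|\mathcal{H}|,|\mathcal{K}|=O(n^4)$.
   Context: Subgraphs are identified with their vertex sets (induced subgraphs), so members of each family are distinct vertex subsets. A family of connected subgraphs of $G$ is non-piercing if for any two members $H,H'$ the subgraph of $G$ induced on $V(H)\setminus V(H')$ is connected. -}

module Defs where

open import Data.Nat using (ℕ; _<_)
open import Data.Bool using (Bool; true; false)
open import Data.Fin using (Fin; toℕ)
open import Data.Fin.Subset using (Subset; _∈_; _─_; Nonempty)
open import Data.Product using (Σ; _×_; ∃)
open import Data.List using (List)
open import Data.List.Relation.Unary.All using (All)
open import Data.List.Relation.Unary.Unique.Propositional using (Unique)
open import Relation.Binary.PropositionalEquality using (_≡_)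
open import Relation.Nullary using (¬_)
open import Function.Definitions using (Injective)

record Graph (n : ℕ) : Set where
  field
    Adj   : Fin n → Fin n → Bool
    sym   : ∀ u v → Adj u v ≡ Adj v u
    irrefl : ∀ u → Adj u u ≡ false
open Graph public

-- Outerplanar: vertices can be placed in a cyclic (here: linear) order on a
-- circle so that no two edges (drawn as chords) cross.
-- Chords {a,b} and {c,d} cross iff pos a < pos c < pos b < pos d.
Outerplanar : ∀ {n} → Graph n → Set
Outerplanar {n} G =
  Σ (Fin n → Fin n) λ pos → Injective _≡_ _≡_ pos ×
    (∀ a b c d → Adj G a b ≡ true → Adj G c d ≡ true →
      ¬ (toℕ (pos a) < toℕ (pos c) × toℕ (pos c) < toℕ (pos b)
         × toℕ (pos b) < toℕ (pos d)))

data Reach {n} (G : Graph n) (S : Subset n) : Fin n → Fin n → Set where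
  here : ∀ {u} → u ∈ S → Reach G S u u
  step : ∀ {u w v} → u ∈ S → Adj G u w ≡ true → Reach G S w v → Reach G S u v

-- The subgraph of G induced on S is connected (the empty graph counts as connected).
Connected : ∀ {n} → Graph n → Subset n → Set
Connected G S = ∀ u v → u ∈ S → v ∈ S → Reach G S u v

-- A connected subgraph, identified with its (nonempty) vertex set.
ConnectedSubgraph : ∀ {n} → Graph n → Subset n → Set
ConnectedSubgraph G S = Nonempty S × Connected G S

NonPiercingFamily : ∀ {n} → Graph n → List (Subset n) → Set
NonPiercingFamily G F =
  Unique F × All (ConnectedSubgraph G) F ×
  All (λ H → All (λ H' → Connected G (H ─ H')) F) F

-- Place the vertices at their positions on the circle. A non-piercing family then has
-- VC-dimension at most 3: if it shattered four places p₁ < p₂ < p₃ < p₄, there would be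
-- members A, B with the vertices at p₁, p₃ in A ─ B and those at p₂, p₄ in B ─ A, hence
-- vertex-disjoint walks p₁ ⇝ p₃ and p₂ ⇝ p₄. Whether a place lies between the ends of a
-- walk is the xor, over its edges, of whether it lies between the ends of that edge; as
-- chords of an outerplanar drawing do not cross, every edge of the second walk keeps both
-- ends on the same side of the first walk, contradicting that p₂ is between p₁ and p₃
-- while p₄ is not. The Sauer–Shelah lemma then bounds the family by Φ n 4 ≤ (n + 1)³.

module Submission where

open import Defs using (Graph; Adj; Outerplanar; Reach; here; step; NonPiercingFamily)
open import Data.Bool using (Bool; true; false; _xor_)
open import Data.Bool.Properties using (xor-same; xor-comm; xor-assoc) renaming (_≟_ to _≟ᵇ_)
open import Data.Empty using (⊥; ⊥-elim)
open import Data.Fin using (Fin; zero; suc; toℕ; _≟_)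
import Data.Fin as Fin
open import Data.Fin.Patterns using (0F; 1F; 2F; 3F)
open import Data.Fin.Subset using () renaming (⊥ to ∅)
open import Data.Fin.Properties using (any?; toℕ-injective; <-cmp; <⇒≢)
open import Data.Fin.Subset using (Subset; ∣_∣; _∩_; _∪_; _─_; ⁅_⁆; _∈_; _∉_; _⊆_; outside; inside)
open import Data.Fin.Subset.Properties
  using (∩-zeroˡ; ⊆-antisym; _∈?_; x∈p∩q⁺; x∈p∩q⁻; x∈p∪q⁺; x∈p∪q⁻; x∈⁅x⁆; x∈⁅y⁆⇒x≡y; x∈p∧x∉q⇒x∈p─q; p─q⊆p)
open import Data.List using (List; []; _∷_; length; filter; map; _++_)
import Data.List.Membership.Propositional as List
open import Data.List.Membership.Propositional.Properties using (∈-filter⁻; ∈-++⁻; ∈-map⁻)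
import Data.List.Membership.DecPropositional as DecMembership
open import Data.List.Properties using (length-++; length-map)
open import Data.List.Relation.Unary.Any using (here; there)
import Data.List.Relation.Unary.All as All
open import Data.List.Relation.Unary.Unique.Propositional using (Unique; []; _∷_)
import Data.List.Relation.Unary.Unique.Propositional.Properties as Unique
open import Data.Nat using (ℕ; zero; suc; _+_; _*_; _^_; _<_; _≤_; _<ᵇ_; z≤n; s≤s; z<s; s<s)
open import Data.Nat.Properties
  using (+-suc; +-assoc; +-comm; +-identityʳ; +-mono-≤; *-monoʳ-≤; ^-monoˡ-≤; ^-monoʳ-≤; m^n>0; n≤1+n; m≤m+n;
         <ᵇ-reflects-<; ≮⇒≥; <⇒≱; <⇒≤; ≤∧≢⇒<; <-trans; module ≤-Reasoning)
import Data.Nat.Properties as ℕ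
open import Data.Nat.Solver using (module +-*-Solver)
open import Data.Product using (∃; ∃-syntax; _×_; _,_; proj₁; proj₂)
open import Data.Sum using (_⊎_; inj₁; inj₂; [_,_]′)
open import Data.Vec using (_∷_; []; tabulate; here; there)
open import Data.Vec.Properties using (≡-dec; lookup∘tabulate; lookup⇒[]=; []=⇒lookup)
open import Function using (_∘_)
open import Function.Definitions using (Injective)
open import Relation.Binary.Core using (_Preserves_⟶_)
open import Relation.Binary.Definitions using (tri<; tri≈; tri>)
open import Relation.Binary.PropositionalEquality
  using (_≡_; _≢_; refl; sym; trans; cong; cong₂; subst; module ≡-Reasoning)
open import Relation.Nullary using (¬_; Dec; yes; no; does; _×-dec_)
open import Relation.Nullary.Decidable using (dec-true)
open import Relation.Nullary.Reflects using (ofʸ; ofⁿ)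
open import Relation.Unary using (Pred; Decidable)
open import Relation.Unary.Properties using (∁?)

-- Φ n d = Σ_{i<d} (n choose i), the Sauer–Shelah bound.
Φ : ℕ → ℕ → ℕ
Φ n       zero    = 0
Φ zero    (suc d) = 1
Φ (suc n) (suc d) = Φ n (suc d) + Φ n d

Φ-bound : ∀ n d → Φ n (suc d) ≤ suc n ^ d
Φ-bound zero    d       = m^n>0 1 d
Φ-bound (suc n) zero    = subst (_≤ 1) (sym (+-identityʳ (Φ n 1))) (Φ-bound n zero)
Φ-bound (suc n) (suc d) = begin
  Φ n (suc (suc d)) + Φ n (suc d)          ≤⟨ +-mono-≤ (Φ-bound n (suc d)) (Φ-bound n d) ⟩
  suc n * suc n ^ d + suc n ^ d            ≡⟨ +-comm (suc n * suc n ^ d) (suc n ^ d) ⟩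
  suc n ^ d + suc n * suc n ^ d            ≤⟨ +-mono-≤ grow (*-monoʳ-≤ (suc n) grow) ⟩
  suc (suc n) ^ d + suc n * suc (suc n) ^ d ∎
  where
  open ≤-Reasoning
  grow : suc n ^ d ≤ suc (suc n) ^ d
  grow = ^-monoˡ-≤ d (n≤1+n (suc n))

Φ-four-bound : ∀ m → Φ (suc m) 4 ≤ 8 * suc m ^ 4
Φ-four-bound m = begin
  Φ (suc m) 4         ≤⟨ Φ-bound (suc m) 3 ⟩
  suc (suc m) ^ 3     ≤⟨ ^-monoˡ-≤ 3 (subst (suc (suc m) ≤_) (sym (double m)) (m≤m+n (suc (suc m)) m)) ⟩
  (2 * suc m) ^ 3     ≡⟨ cube-double (suc m) ⟩
  8 * suc m ^ 3       ≤⟨ *-monoʳ-≤ 8 (^-monoʳ-≤ (suc m) (n≤1+n 3)) ⟩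
  8 * suc m ^ 4       ∎
  where
  open ≤-Reasoning
  open +-*-Solver using (solve; _:*_; _:+_; _:^_; _:=_; con)
  double : ∀ m → 2 * suc m ≡ suc (suc m) + m
  double = solve 1 (λ m → con 2 :* (con 1 :+ m) := (con 2 :+ m) :+ m) refl
  cube-double : ∀ k → (2 * k) ^ 3 ≡ 8 * k ^ 3
  cube-double = solve 1 (λ k → (con 2 :* k) :^ 3 := con 8 :* (k :^ 3)) refl

length-filter+length-filter-∁ : ∀ {a p} {A : Set a} {P : Pred A p} (P? : Decidable P) xs →
  length (filter P? xs) + length (filter (∁? P?) xs) ≡ length xs
length-filter+length-filter-∁ P? [] = refl
length-filter+length-filter-∁ P? (x ∷ xs) with does (P? x)
... | true  = cong suc (length-filter+length-filter-∁ P? xs)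
... | false = trans (+-suc _ _) (cong suc (length-filter+length-filter-∁ P? xs))

tailsWith : ∀ {n} → Bool → List (Subset (suc n)) → List (Subset n)
tailsWith b [] = []
tailsWith b ((x ∷ S) ∷ F) with x ≟ᵇ b
... | yes _ = S ∷ tailsWith b F
... | no  _ = tailsWith b F

∈-tailsWith⁻ : ∀ {n b S} (F : List (Subset (suc n))) → S List.∈ tailsWith b F → (b ∷ S) List.∈ F
∈-tailsWith⁻ {b = b} ((x ∷ S) ∷ F) m with x ≟ᵇ b
∈-tailsWith⁻ ((x ∷ S) ∷ F) (here refl) | yes refl = here refl
∈-tailsWith⁻ ((x ∷ S) ∷ F) (there m)   | yes _    = there (∈-tailsWith⁻ F m)
∈-tailsWith⁻ ((x ∷ S) ∷ F) m           | no  _    = there (∈-tailsWith⁻ F m)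

tailsWith-unique : ∀ {n} b {F : List (Subset (suc n))} → Unique F → Unique (tailsWith b F)
tailsWith-unique b [] = []
tailsWith-unique b {(x ∷ S) ∷ F} (S∉F ∷ uniq) with x ≟ᵇ b
... | yes refl = All.tabulate (λ { m refl → All.lookup S∉F (∈-tailsWith⁻ F m) refl }) ∷ tailsWith-unique b uniq
... | no  _    = tailsWith-unique b uniq

length-tailsWith : ∀ {n} (F : List (Subset (suc n))) →
  length F ≡ length (tailsWith false F) + length (tailsWith true F)
length-tailsWith [] = refl
length-tailsWith ((false ∷ S) ∷ F) = cong suc (length-tailsWith F)
length-tailsWith ((true  ∷ S) ∷ F) = trans (cong suc (length-tailsWith F)) (sym (+-suc _ _))

-- The trace X ∩ S is written with X first so that it computes on the head of X.
Shatters : ∀ {n} → List (Subset n) → Subset n → Set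
Shatters F X = ∀ P → ∃[ S ] S List.∈ F × X ∩ S ≡ X ∩ P

VCDimensionBelow : ∀ {n} → ℕ → List (Subset n) → Set
VCDimensionBelow d F = ∀ X → d ≤ ∣ X ∣ → ¬ Shatters F X

sauer-shelah : ∀ n d (F : List (Subset n)) → Unique F → VCDimensionBelow d F → length F ≤ Φ n d
sauer-shelah n zero [] _ _ = z≤n
sauer-shelah n zero (S ∷ F) _ vc = ⊥-elim (vc ∅ z≤n λ P → S , here refl , trans (∩-zeroˡ S) (sym (∩-zeroˡ P)))
sauer-shelah zero (suc d) [] _ _ = z≤n
sauer-shelah zero (suc d) ([] ∷ []) _ _ = s≤s z≤n
sauer-shelah zero (suc d) ([] ∷ [] ∷ _) (distinct ∷ _) _ = ⊥-elim (All.head distinct refl)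
sauer-shelah (suc n) (suc d) F uniq vc = begin
  length F                                       ≡⟨ length-tailsWith F ⟩
  length F₀ + length F₁                          ≡⟨ cong (length F₀ +_) (sym (length-filter+length-filter-∁ (_∈ₗ? F₀) F₁)) ⟩
  length F₀ + (length both + length only₁)       ≡⟨ cong (length F₀ +_) (+-comm (length both) (length only₁)) ⟩
  length F₀ + (length only₁ + length both)       ≡⟨ sym (+-assoc (length F₀) (length only₁) (length both)) ⟩
  (length F₀ + length only₁) + length both       ≡⟨ cong (_+ length both) (sym (length-++ F₀)) ⟩
  length (F₀ ++ only₁) + length both             ≤⟨ +-mono-≤ (sauer-shelah n (suc d) (F₀ ++ only₁) uniq-∪ vc-∪)
                                                             (sauer-shelah n d both uniq-both vc-both) ⟩
  Φ n (suc d) + Φ n d                            ∎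
  where
  open ≤-Reasoning
  open DecMembership (≡-dec _≟ᵇ_) using () renaming (_∈?_ to _∈ₗ?_; _∉?_ to _∉ₗ?_)
  F₀ F₁ both only₁ : List (Subset n)
  F₀ = tailsWith false F
  F₁ = tailsWith true F
  both = filter (_∈ₗ? F₀) F₁
  only₁ = filter (_∉ₗ? F₀) F₁

  uniq-∪ : Unique (F₀ ++ only₁)
  uniq-∪ = Unique.++⁺ (tailsWith-unique false uniq) (Unique.filter⁺ (_∉ₗ? F₀) (tailsWith-unique true uniq))
                      (λ (m₀ , m) → proj₂ (∈-filter⁻ (_∉ₗ? F₀) {xs = F₁} m) m₀)

  uniq-both : Unique both
  uniq-both = Unique.filter⁺ (_∈ₗ? F₀) (tailsWith-unique true uniq)

  vc-∪ : VCDimensionBelow (suc d) (F₀ ++ only₁)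
  vc-∪ X d<∣X∣ shatters = vc (false ∷ X) d<∣X∣ λ { (_ ∷ P) → lift (shatters P) }
    where
    lift : ∀ {P} → ∃[ S ] S List.∈ F₀ ++ only₁ × X ∩ S ≡ X ∩ P →
           ∃[ S ] S List.∈ F × (false ∷ X) ∩ S ≡ false ∷ X ∩ P
    lift (S , m , trace) = [ (λ m₀ → (false ∷ S) , ∈-tailsWith⁻ F m₀ , cong (false ∷_) trace)
                           , (λ m₁ → (true ∷ S) , ∈-tailsWith⁻ F (proj₁ (∈-filter⁻ (_∉ₗ? F₀) {xs = F₁} m₁))
                                                , cong (false ∷_) trace)
                           ]′ (∈-++⁻ F₀ m)

  vc-both : VCDimensionBelow d both
  vc-both X d≤∣X∣ shatters = vc (true ∷ X) (s≤s d≤∣X∣) λ { (p ∷ P) → extend p (shatters P) }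
    where
    extend : ∀ {P} p → ∃[ S ] S List.∈ both × X ∩ S ≡ X ∩ P →
             ∃[ S ] S List.∈ F × (true ∷ X) ∩ S ≡ p ∷ X ∩ P
    extend false (S , m , trace) =
      (false ∷ S) , ∈-tailsWith⁻ F (proj₂ (∈-filter⁻ (_∈ₗ? F₀) {xs = F₁} m)) , cong (false ∷_) trace
    extend true  (S , m , trace) =
      (true ∷ S) , ∈-tailsWith⁻ F (proj₁ (∈-filter⁻ (_∈ₗ? F₀) {xs = F₁} m)) , cong (true ∷_) trace

x∈p─q⇒x∉q : ∀ {n} {p q : Subset n} {x} → x ∈ p ─ q → x ∉ q
x∈p─q⇒x∉q {p = inside ∷ _} {outside ∷ _} here      ()
x∈p─q⇒x∉q {p = _ ∷ _}      {_ ∷ _}       (there m) (there m′) = x∈p─q⇒x∉q m m′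

∉-pair : ∀ {n} {t u w : Fin n} → t ≢ u → t ≢ w → t ∉ ⁅ u ⁆ ∪ ⁅ w ⁆
∉-pair t≢u t≢w t∈ = [ t≢u ∘ x∈⁅y⁆⇒x≡y _ , t≢w ∘ x∈⁅y⁆⇒x≡y _ ]′ (x∈p∪q⁻ _ _ t∈)

trace-∈ : ∀ {n} {X S P : Subset n} {t} → X ∩ S ≡ X ∩ P → t ∈ X → t ∈ P → t ∈ S
trace-∈ {X = X} {S} trace t∈X t∈P = proj₂ (x∈p∩q⁻ X S (subst (_ ∈_) (sym trace) (x∈p∩q⁺ (t∈X , t∈P))))

trace-∉ : ∀ {n} {X S P : Subset n} {t} → X ∩ S ≡ X ∩ P → t ∈ X → t ∉ P → t ∉ S
trace-∉ {X = X} {P = P} trace t∈X t∉P t∈S = t∉P (proj₂ (x∈p∩q⁻ X P (subst (_ ∈_) trace (x∈p∩q⁺ (t∈X , t∈S)))))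

ascending-members : ∀ {n} k (X : Subset n) → k ≤ ∣ X ∣ →
  ∃[ f ] (∀ j → f j ∈ X) × f Preserves Fin._<_ ⟶ Fin._<_
ascending-members zero    X             _        = (λ ()) , (λ ()) , λ { {()} }
ascending-members (suc k) (inside ∷ X)  (s≤s k≤) with ascending-members k X k≤
... | f , f∈X , f< = g , g∈ , g<
  where
  g : Fin (suc k) → Fin _
  g zero    = zero
  g (suc j) = suc (f j)
  g∈ : ∀ j → g j ∈ inside ∷ X
  g∈ zero    = here
  g∈ (suc j) = there (f∈X j)
  g< : g Preserves Fin._<_ ⟶ Fin._<_
  g< {zero}  {suc j} _         = z<s
  g< {suc i} {suc j} (s<s i<j) = s<s (f< i<j)
ascending-members (suc k) (outside ∷ X) k≤ with ascending-members (suc k) X k≤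
... | f , f∈X , f< = suc ∘ f , there ∘ f∈X , s<s ∘ f<

strictlyMonotone⇒injective : ∀ {m n} {f : Fin m → Fin n} → f Preserves Fin._<_ ⟶ Fin._<_ → Injective _≡_ _≡_ f
strictlyMonotone⇒injective f< {i} {j} fi≡fj with <-cmp i j
... | tri< i<j _ _ = ⊥-elim (<⇒≢ (f< i<j) fi≡fj)
... | tri≈ _ i≡j _ = i≡j
... | tri> _ _ j<i = ⊥-elim (<⇒≢ (f< j<i) (sym fi≡fj))

toSubset : ∀ {n p} {P : Pred (Fin n) p} → Decidable P → Subset n
toSubset P? = tabulate (does ∘ P?)

∈-toSubset⁺ : ∀ {n p} {P : Pred (Fin n) p} (P? : Decidable P) {i} → P i → i ∈ toSubset P?
∈-toSubset⁺ {P = P} P? {i} Pi = lookup⇒[]= i _ (trans (lookup∘tabulate (does ∘ P?) i) (dec-true (P? i) Pi))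

∈-toSubset⁻ : ∀ {n p} {P : Pred (Fin n) p} (P? : Decidable P) {i} → i ∈ toSubset P? → P i
∈-toSubset⁻ {P = P} P? {i} i∈ = witness (P? i) (trans (sym (lookup∘tabulate (does ∘ P?) i)) ([]=⇒lookup i∈))
  where
  witness : (d : Dec (P i)) → does d ≡ true → P i
  witness (yes Pi) _  = Pi
  witness (no _)   ()

hasPreimage? : ∀ {m n} (f : Fin m → Fin n) (S : Subset m) → Decidable λ i → ∃[ v ] v ∈ S × f v ≡ i
hasPreimage? f S i = any? λ v → v ∈? S ×-dec f v ≟ i

image : ∀ {m n} → (Fin m → Fin n) → Subset m → Subset n
image f S = toSubset (hasPreimage? f S)

∈-image⁺ : ∀ {m n} {f : Fin m → Fin n} {S v} → v ∈ S → f v ∈ image f S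
∈-image⁺ {f = f} {S} v∈S = ∈-toSubset⁺ (hasPreimage? f S) (_ , v∈S , refl)

∈-image⁻ : ∀ {m n} {f : Fin m → Fin n} {S i} → i ∈ image f S → ∃[ v ] v ∈ S × f v ≡ i
∈-image⁻ {f = f} {S} = ∈-toSubset⁻ (hasPreimage? f S)

image-reflects-⊆ : ∀ {m n} {f : Fin m → Fin n} {S T} → Injective _≡_ _≡_ f → image f S ⊆ image f T → S ⊆ T
image-reflects-⊆ {f = f} f-inj fS⊆fT {v} v∈S with ∈-image⁻ (fS⊆fT (∈-image⁺ {f = f} v∈S))
... | w , w∈T , fw≡fv with refl ← f-inj {w} {v} fw≡fv = w∈T

image-injective : ∀ {m n} {f : Fin m → Fin n} → Injective _≡_ _≡_ f → Injective _≡_ _≡_ (image f)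
image-injective f-inj fS≡fT =
  ⊆-antisym (image-reflects-⊆ f-inj (subst (_ ∈_) fS≡fT)) (image-reflects-⊆ f-inj (subst (_ ∈_) (sym fS≡fT)))

-- For z ∉ {x, y}, `between x y z` says whether z lies strictly between x and y.
between : ℕ → ℕ → ℕ → Bool
between x y z = (x <ᵇ z) xor (y <ᵇ z)

between-self : ∀ x z → between x x z ≡ false
between-self x z = xor-same (x <ᵇ z)

between-sym : ∀ x y z → between x y z ≡ between y x z
between-sym x y z = xor-comm (x <ᵇ z) (y <ᵇ z)

between-split : ∀ x w y z → between x y z ≡ between x w z xor between w y z
between-split x w y z = sym (begin
  (a xor b) xor (b xor c) ≡⟨ xor-assoc a b (b xor c) ⟩
  a xor (b xor (b xor c)) ≡⟨ cong (a xor_) (sym (xor-assoc b b c)) ⟩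
  a xor ((b xor b) xor c) ≡⟨ cong (λ t → a xor (t xor c)) (xor-same b) ⟩
  a xor c                 ∎)
  where
  open ≡-Reasoning
  a b c : Bool
  a = x <ᵇ z
  b = w <ᵇ z
  c = y <ᵇ z

between-true⇒ : ∀ {x y z} → x < y → between x y z ≡ true → x < z × z ≤ y
between-true⇒ {x} {y} {z} x<y eq with x <ᵇ z | <ᵇ-reflects-< x z | y <ᵇ z | <ᵇ-reflects-< y z
between-true⇒ x<y _  | true  | ofʸ x<z | false | ofⁿ y≮z = x<z , ≮⇒≥ y≮z
between-true⇒ x<y _  | false | ofⁿ x≮z | true  | ofʸ y<z = ⊥-elim (x≮z (<-trans x<y y<z))
between-true⇒ x<y () | true  | _       | true  | _
between-true⇒ x<y () | false | _       | false | _

between-inside : ∀ {x y z} → x < z → z ≤ y → between x y z ≡ true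
between-inside {x} {y} {z} x<z z≤y with x <ᵇ z | <ᵇ-reflects-< x z | y <ᵇ z | <ᵇ-reflects-< y z
... | true  | _       | false | _       = refl
... | false | ofⁿ x≮z | _     | _       = ⊥-elim (x≮z x<z)
... | true  | _       | true  | ofʸ y<z = ⊥-elim (<⇒≱ y<z z≤y)

between-false⇒ : ∀ {x y z} → between x y z ≡ false → z ≤ x ⊎ y < z
between-false⇒ {x} {y} {z} eq with x <ᵇ z | <ᵇ-reflects-< x z | y <ᵇ z | <ᵇ-reflects-< y z
between-false⇒ _  | true  | _        | true  | ofʸ y<z = inj₂ y<z
between-false⇒ _  | false | ofⁿ x≮z | false | _       = inj₁ (≮⇒≥ x≮z)
between-false⇒ () | true  | _        | false | _
between-false⇒ () | false | _        | true  | _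

module Drawing {n} (G : Graph n) (outerplanar : Outerplanar G) where

  pos : Fin n → Fin n
  pos = proj₁ outerplanar

  pos-injective : Injective _≡_ _≡_ pos
  pos-injective = proj₁ (proj₂ outerplanar)

  place : Fin n → ℕ
  place v = toℕ (pos v)

  place-injective : ∀ {u v} → place u ≡ place v → u ≡ v
  place-injective = pos-injective ∘ toℕ-injective

  adj-sym : ∀ {u v} → Adj G u v ≡ true → Adj G v u ≡ true
  adj-sym {u} {v} uv = trans (Graph.sym G v u) uv

  chords-don't-cross : ∀ {a b c d} → Adj G a b ≡ true → Adj G c d ≡ true →
    place a < place c → place c < place b → place b < place d → ⊥
  chords-don't-cross ab cd a<c c<b b<d = proj₂ (proj₂ outerplanar) _ _ _ _ ab cd (a<c , c<b , b<d)

  onArc : Fin n → Fin n → Fin n → Bool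
  onArc a b z = between (place a) (place b) (place z)

  chord-doesn't-separate : ∀ {a b c d} → Adj G a b ≡ true → Adj G c d ≡ true → place a < place b →
    c ≢ b → d ≢ a → onArc a b c ≡ true → onArc a b d ≡ false → ⊥
  chord-doesn't-separate ab cd a<b c≢b d≢a c-in d-out with between-true⇒ a<b c-in | between-false⇒ d-out
  ... | a<c , c≤b | inj₂ b<d = chords-don't-cross ab cd a<c (≤∧≢⇒< c≤b (c≢b ∘ place-injective)) b<d
  ... | a<c , c≤b | inj₁ d≤a =
    chords-don't-cross (adj-sym cd) ab (≤∧≢⇒< d≤a (d≢a ∘ place-injective)) a<c (≤∧≢⇒< c≤b (c≢b ∘ place-injective))

  chord-side< : ∀ {a b c d} → Adj G a b ≡ true → Adj G c d ≡ true → place a < place b →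
    c ≢ a → c ≢ b → d ≢ a → d ≢ b → onArc a b c ≡ onArc a b d
  chord-side< {a} {b} {c} {d} ab cd a<b c≢a c≢b d≢a d≢b with onArc a b c in c-side | onArc a b d in d-side
  ... | true  | true  = refl
  ... | false | false = refl
  ... | true  | false = ⊥-elim (chord-doesn't-separate ab cd a<b c≢b d≢a c-side d-side)
  ... | false | true  = ⊥-elim (chord-doesn't-separate ab (adj-sym cd) a<b d≢b c≢a d-side c-side)

  chord-side : ∀ {a b c d} → Adj G a b ≡ true → Adj G c d ≡ true →
    c ≢ a → c ≢ b → d ≢ a → d ≢ b → onArc a b c ≡ onArc a b d
  chord-side {a} {b} {c} {d} ab cd c≢a c≢b d≢a d≢b with ℕ.<-cmp (place a) (place b)
  ... | tri< a<b _ _ = chord-side< ab cd a<b c≢a c≢b d≢a d≢b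
  ... | tri> _ _ b<a = begin
    onArc a b c  ≡⟨ between-sym (place a) (place b) (place c) ⟩
    onArc b a c  ≡⟨ chord-side< (adj-sym ab) cd b<a c≢b c≢a d≢b d≢a ⟩
    onArc b a d  ≡⟨ between-sym (place b) (place a) (place d) ⟩
    onArc a b d  ∎
    where open ≡-Reasoning
  ... | tri≈ _ a≡b _ = trans (degenerate c) (sym (degenerate d))
    where
    degenerate : ∀ z → onArc a b z ≡ false
    degenerate z = trans (cong (λ x → between x (place b) (place z)) a≡b) (between-self (place b) (place z))

  walk-source : ∀ {S u v} → Reach G S u v → u ∈ S
  walk-source (here u∈S)     = u∈S
  walk-source (step u∈S _ _) = u∈S

  walk-doesn't-separate-chord : ∀ {S a b u w} → Reach G S a b → u ∉ S → w ∉ S → Adj G u w ≡ true →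
    onArc a b u ≡ onArc a b w
  walk-doesn't-separate-chord {a = a} {u = u} {w} (here _) _ _ _ =
    trans (between-self (place a) (place u)) (sym (between-self (place a) (place w)))
  walk-doesn't-separate-chord {S} {a} {b} {u} {w} (step {w = a′} a∈S aa′ walk) u∉S w∉S uw = begin
    onArc a b u                    ≡⟨ between-split (place a) (place a′) (place b) (place u) ⟩
    onArc a a′ u xor onArc a′ b u  ≡⟨ cong₂ _xor_
                                        (chord-side aa′ uw (apart a∈S u∉S) (apart a′∈S u∉S) (apart a∈S w∉S) (apart a′∈S w∉S))
                                        (walk-doesn't-separate-chord walk u∉S w∉S uw) ⟩
    onArc a a′ w xor onArc a′ b w  ≡⟨ between-split (place a) (place a′) (place b) (place w) ⟨
    onArc a b w                    ∎
    where
    open ≡-Reasoning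
    a′∈S : a′ ∈ S
    a′∈S = walk-source walk
    apart : ∀ {S x y} → x ∈ S → y ∉ S → y ≢ x
    apart x∈S y∉S refl = y∉S x∈S

  disjoint-walks-same-side : ∀ {S T a b c d} → Reach G S a b → Reach G T c d → (∀ {v} → v ∈ S → v ∉ T) →
    onArc a b c ≡ onArc a b d
  disjoint-walks-same-side P (here _) disjoint = refl
  disjoint-walks-same-side P (step c∈T cc′ Q) disjoint =
    trans (walk-doesn't-separate-chord P (λ c∈S → disjoint c∈S c∈T) (λ c′∈S → disjoint c′∈S (walk-source Q)) cc′)
          (disjoint-walks-same-side P Q disjoint)

  disjoint-walks-don't-interleave : ∀ {S T a b c d} → Reach G S a b → Reach G T c d → (∀ {v} → v ∈ S → v ∉ T) →
    place a < place c → place c < place b → place b < place d → ⊥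
  disjoint-walks-don't-interleave P Q disjoint a<c c<b b<d =
    <⇒≱ b<d (proj₂ (between-true⇒ (<-trans a<c c<b)
      (trans (sym (disjoint-walks-same-side P Q disjoint)) (between-inside a<c (<⇒≤ c<b)))))

module NonPiercing {n} (G : Graph n) (outerplanar : Outerplanar G)
                   (F : List (Subset n)) (nonPiercing : NonPiercingFamily G F) where

  open Drawing G outerplanar

  difference-connected : ∀ {A B} → A List.∈ F → B List.∈ F →
    ∀ {u v} → u ∈ A ─ B → v ∈ A ─ B → Reach G (A ─ B) u v
  difference-connected A∈F B∈F u∈ v∈ = All.lookup (All.lookup (proj₂ (proj₂ nonPiercing)) A∈F) B∈F _ _ u∈ v∈

  no-alternating-quadruple : ∀ {A B a b c d} → A List.∈ F → B List.∈ F →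
    a ∈ A ─ B → b ∈ B ─ A → c ∈ A ─ B → d ∈ B ─ A → place a < place b → place b < place c → place c < place d → ⊥
  no-alternating-quadruple {A} {B} A∈F B∈F a∈ b∈ c∈ d∈ =
    disjoint-walks-don't-interleave (difference-connected A∈F B∈F a∈ c∈) (difference-connected B∈F A∈F b∈ d∈)
      (λ v∈A─B v∈B─A → x∈p─q⇒x∉q v∈B─A (p─q⊆p A B v∈A─B))

  realize : ∀ {X} → Shatters (map (image pos) F) X → ∀ P → ∃[ A ] A List.∈ F × X ∩ image pos A ≡ X ∩ P
  realize shatters P with shatters P
  ... | S , S∈ , trace with ∈-map⁻ (image pos) S∈
  ...   | A , A∈F , refl = A , A∈F , trace

  separated-vertex : ∀ {X A B P Q t} → X ∩ image pos A ≡ X ∩ P → X ∩ image pos B ≡ X ∩ Q →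
    t ∈ X → t ∈ P → t ∉ Q → ∃[ v ] v ∈ A ─ B × pos v ≡ t
  separated-vertex traceA traceB t∈X t∈P t∉Q with ∈-image⁻ {f = pos} (trace-∈ traceA t∈X t∈P)
  ... | v , v∈A , refl = v , x∈p∧x∉q⇒x∈p─q v∈A (trace-∉ traceB t∈X t∉Q ∘ ∈-image⁺) , refl

  ascending-quadruple-not-shattered : ∀ {X} (i : Fin 4 → Fin n) → (∀ k → i k ∈ X) →
    i Preserves Fin._<_ ⟶ Fin._<_ → ¬ Shatters (map (image pos) F) X
  ascending-quadruple-not-shattered i i∈X i< shatters =
    let A , A∈F , traceA = realize shatters (pair 0F 2F)
        B , B∈F , traceB = realize shatters (pair 1F 3F)
        a , a∈ , pa = separated-vertex traceA traceB (i∈X 0F) (first 0F 2F) (∉-pair (distinct λ ()) (distinct λ ()))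
        b , b∈ , pb = separated-vertex traceB traceA (i∈X 1F) (first 1F 3F) (∉-pair (distinct λ ()) (distinct λ ()))
        c , c∈ , pc = separated-vertex traceA traceB (i∈X 2F) (second 0F 2F) (∉-pair (distinct λ ()) (distinct λ ()))
        d , d∈ , pd = separated-vertex traceB traceA (i∈X 3F) (second 1F 3F) (∉-pair (distinct λ ()) (distinct λ ()))
    in no-alternating-quadruple A∈F B∈F a∈ b∈ c∈ d∈
         (placed pa pb (i< z<s)) (placed pb pc (i< (s<s z<s))) (placed pc pd (i< (s<s (s<s z<s))))
    where
    pair : Fin 4 → Fin 4 → Subset n
    pair k l = ⁅ i k ⁆ ∪ ⁅ i l ⁆
    first : ∀ k l → i k ∈ pair k l
    first k l = x∈p∪q⁺ (inj₁ (x∈⁅x⁆ (i k)))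
    second : ∀ k l → i l ∈ pair k l
    second k l = x∈p∪q⁺ (inj₂ (x∈⁅x⁆ (i l)))
    distinct : ∀ {k l} → k ≢ l → i k ≢ i l
    distinct k≢l = k≢l ∘ strictlyMonotone⇒injective i<
    placed : ∀ {u v s t} → pos u ≡ s → pos v ≡ t → s Fin.< t → place u < place v
    placed refl refl s<t = s<t

  four-places-not-shattered : VCDimensionBelow 4 (map (image pos) F)
  four-places-not-shattered X 4≤∣X∣ =
    let i , i∈X , i< = ascending-members 4 X 4≤∣X∣ in ascending-quadruple-not-shattered i i∈X i<

non-piercing-family-size : ∀ {n} (G : Graph n) → Outerplanar G → (F : List (Subset n)) →
  NonPiercingFamily G F → length F ≤ 8 * n ^ 4
non-piercing-family-size {zero}  G outerplanar []      _ = z≤n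
non-piercing-family-size {zero}  G outerplanar (_ ∷ _) (_ , connected , _) with (() , _) , _ ← All.head connected
non-piercing-family-size {suc m} G outerplanar F nonPiercing = begin
  length F                    ≡⟨ length-map (image pos) F ⟨
  length (map (image pos) F)  ≤⟨ sauer-shelah (suc m) 4 (map (image pos) F)
                                   (Unique.map⁺ (image-injective pos-injective) (proj₁ nonPiercing))
                                   (NonPiercing.four-places-not-shattered G outerplanar F nonPiercing) ⟩
  Φ (suc m) 4                 ≤⟨ Φ-four-bound m ⟩
  8 * suc m ^ 4               ∎
  where
  open ≤-Reasoning
  open Drawing G outerplanar using (pos; pos-injective)

theorem10 : ∃ λ (C : ℕ) → ∀ (n : ℕ) (G : Graph n) → Outerplanar G →
    (ℋ 𝒦 : List (Subset n)) → NonPiercingFamily G ℋ → NonPiercingFamily G 𝒦 →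
    (length ℋ ≤ C * n ^ 4) × (length 𝒦 ≤ C * n ^ 4)
theorem10 = 8 , λ n G outerplanar ℋ 𝒦 ℋ-np 𝒦-np →
  non-piercing-family-size G outerplanar ℋ ℋ-np , non-piercing-family-size G outerplanar 𝒦 𝒦-np
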